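{- Let $a,b\geq 0$ be integers. Then there exists a $(4\cdot 5^a\times 24\cdot 5^b,g\times h,\{4,5\},1)$-BDP, where $(g,h)=(4,24)$ if $a=b=0$; $(g,h)=(4,120)$ if $a=0$ and $b\geq 1$; and $(g,h)=(20,24)$ if $a\geq 1$ and $b\geq 0$.
   Context: Let $G$ be a finite additive group and $K$ a set of positive integers. For $C\subseteq G$, $\Delta C$ denotes the multiset of all differences $x-y$ with $(x,y)$ an ordered pair of distinct elements of $C$. A $(G,K,1)$ difference packing is a set $\mathcal B$ of subsets of $G$ (blocks), each of size in $K$, such that the multiset $\bigcup_{B\in\mathcal B}\Delta B$ contains every element of $G$ at most once; its difference leave is the set of elements of $G$ not occurring in this multiset. It is balanced (BDP) if the number of blocks of size $k$ is the same for every $k\in K$. For $s\mid u$ and $t\mid v$, a $(u\times v,s\times t,K,1)$-BDP is a balanced $(Z_u\times Z_v,K,1)$ difference packing whose difference leave is exactly the subgroup $(u/s)Z_u\times (v/t)Z_v$. -}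

module Defs where

open import Data.Nat using (ℕ; zero; suc; _+_; _*_; _∸_; _^_; _≤_; _<ᵇ_; NonZero; _/_)
open import Data.Nat.Divisibility using (_∣_)
open import Data.Fin using (Fin; toℕ)
open import Data.Fin.Properties using () renaming (_≟_ to _≟F_)
open import Data.Bool using (if_then_else_)
open import Data.Product using (_×_; _,_; proj₁; proj₂)
open import Data.Product.Properties using (≡-dec)
open import Data.List using (List; []; _∷_; map; filter; concatMap; length)
open import Data.List.Relation.Unary.All using (All)
open import Data.List.Relation.Unary.Unique.Propositional using (Unique)
open import Data.Sum using (_⊎_)
open import Relation.Binary.PropositionalEquality using (_≡_)
open import Relation.Nullary using (¬_; Dec)
open import Relation.Nullary.Decidable using (¬?)

Elem : ℕ → ℕ → Set
Elem u v = Fin u × Fin v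

_≟E_ : ∀ {u v} → (x y : Elem u v) → Dec (x ≡ y)
_≟E_ = ≡-dec _≟F_ _≟F_

subMod : ℕ → ℕ → ℕ → ℕ
subMod n x y = if x <ᵇ y then (x + n) ∸ y else x ∸ y

diff : ∀ {u v} → Elem u v → Elem u v → ℕ × ℕ
diff {u} {v} (x₁ , x₂) (y₁ , y₂) = subMod u (toℕ x₁) (toℕ y₁) , subMod v (toℕ x₂) (toℕ y₂)

-- ΔB: all differences x - y over ordered pairs (x , y) of distinct elements of B
-- (B is a list without repetitions, representing a subset of the group).
Δ : ∀ {u v} → List (Elem u v) → List (ℕ × ℕ)
Δ B = concatMap (λ x → map (λ y → diff x y) (filter (λ y → ¬? (x ≟E y)) B)) B

mult : ∀ {u v} → List (List (Elem u v)) → Elem u v → ℕ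
mult ℬ (g₁ , g₂) = length (filter (λ d → ≡-dec Data.Nat._≟_ Data.Nat._≟_ d (toℕ g₁ , toℕ g₂)) (concatMap Δ ℬ))

numOfSize : ∀ {u v} → ℕ → List (List (Elem u v)) → ℕ
numOfSize k ℬ = length (filter (λ B → length B Data.Nat.≟ k) ℬ)

InSub : ∀ {u v} (s t : ℕ) .{{_ : NonZero s}} .{{_ : NonZero t}} → Elem u v → Set
InSub {u} {v} s t (g₁ , g₂) = ((u / s) ∣ toℕ g₁) × ((v / t) ∣ toℕ g₂)

-- A (u × v, s × t, {4,5}, 1)-BDP: a list of blocks (subsets of Z_u × Z_v given as
-- duplicate-free lists), each of size 4 or 5, with as many blocks of size 4 as of size 5,
-- such that every element occurs at most once in ⋃ ΔB, and the difference leave is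
-- exactly the subgroup (u/s)Z_u × (v/t)Z_v.
record BDP45 (u v s t : ℕ) .{{_ : NonZero s}} .{{_ : NonZero t}} : Set where
  field
    blocks   : List (List (Elem u v))
    distinct : All Unique blocks
    sizes    : All (λ B → length B ≡ 4 ⊎ length B ≡ 5) blocks
    balanced : numOfSize 4 blocks ≡ numOfSize 5 blocks
    packing  : ∀ g → mult blocks g ≤ 1
    leave    : ∀ g → (mult blocks g ≡ 0 → InSub {u} {v} s t g)
                   × (InSub {u} {v} s t g → mult blocks g ≡ 0)

gpar : ℕ → ℕ → ℕ
gpar zero    _ = 4
gpar (suc _) _ = 20

hpar : ℕ → ℕ → ℕ
hpar zero    zero    = 24
hpar zero    (suc _) = 120
hpar (suc _) _       = 24

gpar-nz : ∀ a b → NonZero (gpar a b)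
gpar-nz zero    _ = _
gpar-nz (suc _) _ = _

hpar-nz : ∀ a b → NonZero (hpar a b)
hpar-nz zero    zero    = _
hpar-nz zero    (suc _) = _
hpar-nz (suc _) _       = _

-- Let the points of each block carry labels in Z₅, distinct within the block. Such a block B of
-- Z_u × Z_v lifts to the five blocks {(x + u·(j·i mod 5), y) : (i, (x , y)) ∈ B}, j ∈ Z₅, of
-- Z_{5u} × Z_v; since j(i − i') runs through Z₅ when i ≠ i', every difference of B is lifted to each
-- of its five preimages exactly once. So a packing with leave 5^α Z_u × 5^β Z_v lifts to one with
-- leave 5^α Z_{5u} × 5^β Z_v, and adding the (5^α, 5^β)-multiple of a packing of
-- Z_{5u/5^α} × Z_{v/5^β} with leave 5Z × Z cuts the leave down to 5^{α+1} Z_{5u} × 5^β Z_v.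
-- Induction on a and b (swapping the coordinates for b) then starts from two explicit packings,
-- verified by computation.

module Submission where

open import Defs
open import Data.Bool using (true; false; if_then_else_; T)
open import Data.Empty using (⊥; ⊥-elim)
open import Data.Fin using (Fin; toℕ; fromℕ<)
open import Data.Fin.Properties using (toℕ<n; toℕ-injective; toℕ-fromℕ<; all?)
  renaming (_≟_ to _≟F_)
open import Data.List using (List; []; _∷_; map; filter; concatMap; length; _++_; upTo)
open import Data.List.Membership.Propositional using (_∈_)
open import Data.List.Membership.Propositional.Properties using (∈-map⁻; ∈-upTo⁺)
open import Data.List.Properties using (length-map; map-∘)
open import Data.List.Relation.Unary.All as All using (All; [])
import Data.List.Relation.Unary.All.Properties as All
open import Data.List.Relation.Unary.AllPairs as AllPairs using ()
import Data.List.Relation.Unary.AllPairs.Properties as AllPairs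
open import Data.List.Relation.Unary.Any using (here; there)
open import Data.List.Relation.Unary.Unique.Propositional using (Unique)
open import Data.Nat
open import Data.Nat.DivMod
open import Data.Nat.Divisibility
open import Data.Nat.Properties
open import Data.Nat.Tactic.RingSolver using (solve-∀)
open import Algebra.Properties.CommutativeSemigroup +-commutativeSemigroup using ()
  renaming (interchange to +-interchange)
open import Algebra.Properties.CommutativeSemigroup *-commutativeSemigroup using ()
  renaming (interchange to *-interchange; x∙yz≈y∙xz to *-exchangeˡ)
open import Data.Product using (_×_; _,_; proj₁; proj₂; swap; uncurry)
open import Data.Product.Properties using (≡-dec)
open import Data.Sum using (_⊎_; inj₁; inj₂)
open import Function using (id; _∘_; _⇔_; mk⇔; Equivalence; Injective)
open import Relation.Binary.Definitions using (DecidableEquality)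
open import Relation.Binary.PropositionalEquality
open import Relation.Nullary using (Dec; yes; no; contradiction)
open import Relation.Nullary.Decidable using (¬?; _×-dec_; _⊎-dec_; _→-dec_; from-yes)
open import Relation.Unary using (Decidable)

∑ : ∀ {a} {A : Set a} → List A → (A → ℕ) → ℕ
∑ []       f = 0
∑ (x ∷ xs) f = f x + ∑ xs f

infix 5 ∑
syntax ∑ xs (λ x → e) = ∑[ x ∈ xs ] e

𝟙 : ∀ {p} {P : Set p} → Dec P → ℕ
𝟙 (yes _) = 1
𝟙 (no _)  = 0

module _ {a} {A : Set a} where

  ∑-cong : ∀ (xs : List A) {f g : A → ℕ} → (∀ x → x ∈ xs → f x ≡ g x) → ∑ xs f ≡ ∑ xs g
  ∑-cong []       eq = refl
  ∑-cong (x ∷ xs) eq = cong₂ _+_ (eq x (here refl)) (∑-cong xs (λ y y∈ → eq y (there y∈)))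

  ∑-++ : ∀ (xs ys : List A) f → ∑ (xs ++ ys) f ≡ ∑ xs f + ∑ ys f
  ∑-++ []       ys f = refl
  ∑-++ (x ∷ xs) ys f = trans (cong (f x +_) (∑-++ xs ys f)) (sym (+-assoc (f x) _ _))

  ∑-+ : ∀ (xs : List A) f g → ∑[ x ∈ xs ] (f x + g x) ≡ ∑ xs f + ∑ xs g
  ∑-+ []       f g = refl
  ∑-+ (x ∷ xs) f g = trans (cong (f x + g x +_) (∑-+ xs f g)) (+-interchange (f x) (g x) _ _)

  ∑-*ˡ : ∀ (xs : List A) c f → ∑[ x ∈ xs ] (c * f x) ≡ c * ∑ xs f
  ∑-*ˡ []       c f = sym (*-zeroʳ c)
  ∑-*ˡ (x ∷ xs) c f = trans (cong (c * f x +_) (∑-*ˡ xs c f)) (sym (*-distribˡ-+ c (f x) _))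

  ∑-*ʳ : ∀ (xs : List A) c f → ∑[ x ∈ xs ] (f x * c) ≡ ∑ xs f * c
  ∑-*ʳ []       c f = refl
  ∑-*ʳ (x ∷ xs) c f = trans (cong (f x * c +_) (∑-*ʳ xs c f)) (sym (*-distribʳ-+ c (f x) _))

  ∑-zero : ∀ (xs : List A) → ∑[ x ∈ xs ] 0 ≡ 0
  ∑-zero []       = refl
  ∑-zero (x ∷ xs) = ∑-zero xs

  module _ {p} {P : A → Set p} (P? : Decidable P) where

    length-filter : ∀ xs → length (filter P? xs) ≡ ∑[ x ∈ xs ] 𝟙 (P? x)
    length-filter []       = refl
    length-filter (x ∷ xs) with P? x
    ... | yes _ = cong suc (length-filter xs)
    ... | no  _ = length-filter xs

    ∑-filter : ∀ xs f → ∑ (filter P? xs) f ≡ ∑[ x ∈ xs ] (𝟙 (P? x) * f x)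
    ∑-filter []       f = refl
    ∑-filter (x ∷ xs) f with P? x
    ... | yes _ = cong₂ _+_ (sym (+-identityʳ (f x))) (∑-filter xs f)
    ... | no  _ = ∑-filter xs f

module _ {a b} {A : Set a} {B : Set b} where

  ∑-map : ∀ (h : A → B) xs f → ∑ (map h xs) f ≡ ∑[ x ∈ xs ] f (h x)
  ∑-map h []       f = refl
  ∑-map h (x ∷ xs) f = cong (f (h x) +_) (∑-map h xs f)

  ∑-concatMap : ∀ (h : A → List B) xs f → ∑ (concatMap h xs) f ≡ ∑[ x ∈ xs ] ∑ (h x) f
  ∑-concatMap h []       f = refl
  ∑-concatMap h (x ∷ xs) f =
    trans (∑-++ (h x) (concatMap h xs) f) (cong (∑ (h x) f +_) (∑-concatMap h xs f))

  ∑-comm : ∀ xs ys (f : A → B → ℕ) → ∑[ x ∈ xs ] ∑[ y ∈ ys ] f x y ≡ ∑[ y ∈ ys ] ∑[ x ∈ xs ] f x y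
  ∑-comm []       ys f = sym (∑-zero ys)
  ∑-comm (x ∷ xs) ys f =
    trans (cong (∑ ys (f x) +_) (∑-comm xs ys f)) (sym (∑-+ ys (f x) (λ y → ∑[ x′ ∈ xs ] f x′ y)))

𝟙-yes : ∀ {p} {P : Set p} (P? : Dec P) → P → 𝟙 P? ≡ 1
𝟙-yes (yes _) _ = refl
𝟙-yes (no ¬p) p = contradiction p ¬p

module _ {p q} {P : Set p} {Q : Set q} where

  𝟙-cong : (P? : Dec P) (Q? : Dec Q) → (P → Q) → (Q → P) → 𝟙 P? ≡ 𝟙 Q?
  𝟙-cong (yes _) (yes _) _ _ = refl
  𝟙-cong (no _)  (no _)  _ _ = refl
  𝟙-cong (yes p) (no ¬q) f _ = contradiction (f p) ¬q
  𝟙-cong (no ¬p) (yes q) _ g = contradiction (g q) ¬p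

  𝟙*𝟙≡1 : (P? : Dec P) (Q? : Dec Q) → 𝟙 P? * 𝟙 Q? ≡ 1 → P × Q
  𝟙*𝟙≡1 (yes p) (yes q) _ = p , q
  𝟙*𝟙≡1 (yes _) (no _)  ()
  𝟙*𝟙≡1 (no _)  (yes _) ()
  𝟙*𝟙≡1 (no _)  (no _)  ()

_≟ₚ_ : DecidableEquality (ℕ × ℕ)
_≟ₚ_ = ≡-dec _≟_ _≟_

𝟙-≟ₚ : ∀ a b c d → 𝟙 ((a , b) ≟ₚ (c , d)) ≡ 𝟙 (a ≟ c) * 𝟙 (b ≟ d)
𝟙-≟ₚ a b c d with a ≟ c
... | no _ = refl
... | yes refl with b ≟ d
...   | yes _ = refl
...   | no  _ = refl

-- Modular subtraction

borrow : ℕ → ℕ → ℕ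
borrow x y = if x <ᵇ y then 1 else 0

borrow≤1 : ∀ x y → borrow x y ≤ 1
borrow≤1 x y with x <ᵇ y
... | true  = s≤s z≤n
... | false = z≤n

private
  <ᵇ≡false⇒≥ : ∀ {x y} → (x <ᵇ y) ≡ false → y ≤ x
  <ᵇ≡false⇒≥ e = ≮⇒≥ (λ x<y → subst T e (<⇒<ᵇ x<y))

  <ᵇ≡true⇒< : ∀ {x y} → (x <ᵇ y) ≡ true → x < y
  <ᵇ≡true⇒< {x} {y} e = <ᵇ⇒< x y (subst T (sym e) _)

subMod+y≡x+n*borrow : ∀ n x y → y ≤ x + n → subMod n x y + y ≡ x + n * borrow x y
subMod+y≡x+n*borrow n x y y≤x+n with x <ᵇ y in e
... | true  = trans (m∸n+n≡m y≤x+n) (cong (x +_) (sym (*-identityʳ n)))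
... | false = trans (m∸n+n≡m (<ᵇ≡false⇒≥ {x} {y} e)) (sym (trans (cong (x +_) (*-zeroʳ n)) (+-identityʳ x)))

subMod<n : ∀ n x y → x < n → subMod n x y < n
subMod<n n x y x<n with x <ᵇ y in e
... | false = ≤-<-trans (m∸n≤m x y) x<n
... | true  = begin-strict
  x + n ∸ y     ≤⟨ ∸-monoʳ-≤ (x + n) (<ᵇ≡true⇒< {x} {y} e) ⟩
  x + n ∸ suc x <⟨ ∸-monoʳ-< (n<1+n x) (m<m+n x (≤-<-trans z≤n x<n)) ⟩
  x + n ∸ x     ≡⟨ m+n∸m≡n x n ⟩
  n             ∎
  where open ≤-Reasoning

private
  borrow-gap : ∀ {U X Y D E} → E < U → D + Y ≡ X → E + Y ≡ X + U → ⊥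
  borrow-gap {U} {X} {Y} {D} {E} E<U e₁ e₂ = <⇒≱ E<U (+-cancelʳ-≤ Y U E (begin
    U + Y       ≤⟨ +-monoʳ-≤ U (m≤n+m Y D) ⟩
    U + (D + Y) ≡⟨ cong (U +_) e₁ ⟩
    U + X       ≡⟨ trans (+-comm U X) (sym e₂) ⟩
    E + Y       ∎))
    where open ≤-Reasoning

  no-borrow : ∀ U X → X + U * 0 ≡ X
  no-borrow U X = trans (cong (X +_) (*-zeroʳ U)) (+-identityʳ X)

  one-borrow : ∀ U X → X + U * 1 ≡ X + U
  one-borrow U X = cong (X +_) (*-identityʳ U)

-- Two representatives of x − y below U, each with a borrow of at most one U, coincide.
sub-unique : ∀ {U X Y D E c₁ c₂} → c₁ ≤ 1 → c₂ ≤ 1 → D < U → E < U →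
             D + Y ≡ X + U * c₁ → E + Y ≡ X + U * c₂ → D ≡ E
sub-unique {Y = Y} {D} {E} z≤n z≤n _ _ e₁ e₂ = +-cancelʳ-≡ Y D E (trans e₁ (sym e₂))
sub-unique {Y = Y} {D} {E} (s≤s z≤n) (s≤s z≤n) _ _ e₁ e₂ = +-cancelʳ-≡ Y D E (trans e₁ (sym e₂))
sub-unique {U} {X} z≤n (s≤s z≤n) _ E<U e₁ e₂ =
  ⊥-elim (borrow-gap E<U (trans e₁ (no-borrow U X)) (trans e₂ (one-borrow U X)))
sub-unique {U} {X} (s≤s z≤n) z≤n D<U _ e₁ e₂ =
  ⊥-elim (borrow-gap D<U (trans e₂ (no-borrow U X)) (trans e₁ (one-borrow U X)))

digits< : ∀ {u n a b} → a < u → b < n → a + u * b < u * n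
digits< {u} {n} {a} {b} a<u b<n = begin-strict
  a + u * b <⟨ +-monoˡ-< (u * b) a<u ⟩
  u + u * b ≡⟨ sym (*-suc u b) ⟩
  u * suc b ≤⟨ *-monoʳ-≤ u b<n ⟩
  u * n     ∎
  where open ≤-Reasoning

-- Subtraction with borrow, for numbers in Z_{un} written with a low digit in Z_u and a high digit in Z_n.
subMod-digits : ∀ {u} n {x₀ y₀ r s} → x₀ < u → y₀ < u → r < n → s < n →
  subMod (u * n) (x₀ + u * r) (y₀ + u * s) ≡ subMod u x₀ y₀ + u * subMod n r (s + borrow x₀ y₀)
subMod-digits {u} n {x₀} {y₀} {r} {s} x₀<u y₀<u r<n s<n =
  sub-unique (borrow≤1 X Y) (borrow≤1 r (s + b)) (subMod<n (u * n) X Y (digits< x₀<u r<n))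
    (digits< (subMod<n u x₀ y₀ x₀<u) (subMod<n n r (s + b) r<n))
    (subMod+y≡x+n*borrow (u * n) X Y (≤-trans (<⇒≤ (digits< y₀<u s<n)) (m≤n+m (u * n) X)))
    carry
  where
  b = borrow x₀ y₀
  d = subMod u x₀ y₀
  k = subMod n r (s + b)
  X = x₀ + u * r
  Y = y₀ + u * s

  low : d + y₀ ≡ x₀ + u * b
  low = subMod+y≡x+n*borrow u x₀ y₀ (≤-trans (<⇒≤ y₀<u) (m≤n+m u x₀))

  s+b≤n : s + b ≤ n
  s+b≤n = ≤-trans (≤-trans (+-monoʳ-≤ s (borrow≤1 x₀ y₀)) (≤-reflexive (+-comm s 1))) s<n

  high : k + (s + b) ≡ r + n * borrow r (s + b)
  high = subMod+y≡x+n*borrow n r (s + b) (≤-trans s+b≤n (m≤n+m n r))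

  carry : d + u * k + Y ≡ X + u * n * borrow r (s + b)
  carry = begin
    d + u * k + (y₀ + u * s)          ≡⟨ regroup₁ d u k y₀ s ⟩
    d + y₀ + u * (k + s)              ≡⟨ cong (_+ u * (k + s)) low ⟩
    x₀ + u * b + u * (k + s)          ≡⟨ regroup₂ x₀ u b k s ⟩
    x₀ + u * (k + (s + b))            ≡⟨ cong (λ z → x₀ + u * z) high ⟩
    x₀ + u * (r + n * borrow r (s + b)) ≡⟨ regroup₃ x₀ u r n (borrow r (s + b)) ⟩
    x₀ + u * r + u * n * borrow r (s + b) ∎
    where
    open ≡-Reasoning
    regroup₁ : ∀ d u k y s → d + u * k + (y + u * s) ≡ d + y + u * (k + s)
    regroup₁ = solve-∀
    regroup₂ : ∀ x u b k s → x + u * b + u * (k + s) ≡ x + u * (k + (s + b))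
    regroup₂ = solve-∀
    regroup₃ : ∀ x u r n c → x + u * (r + n * c) ≡ x + u * r + u * n * c
    regroup₃ = solve-∀

𝟙-digits : ∀ u .{{_ : NonZero u}} {d} k t → d < u → 𝟙 (d + u * k ≟ t) ≡ 𝟙 (d ≟ t % u) * 𝟙 (k ≟ t / u)
𝟙-digits u {d} k t d<u with d + u * k ≟ t
... | yes e = sym (cong₂ _*_ (𝟙-yes (d ≟ t % u) d≡t%u) (𝟙-yes (k ≟ t / u) k≡t/u))
  where
  t≡d+ku : t ≡ d + k * u
  t≡d+ku = trans (sym e) (cong (d +_) (*-comm u k))
  d≡t%u : d ≡ t % u
  d≡t%u = sym (trans (cong (_% u) t≡d+ku) (trans ([m+kn]%n≡m%n d k u) (m<n⇒m%n≡m d<u)))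
  k≡t/u : k ≡ t / u
  k≡t/u = *-cancelʳ-≡ k (t / u) u (+-cancelˡ-≡ d (k * u) (t / u * u)
            (trans (sym t≡d+ku) (trans (m≡m%n+[m/n]*n t u) (cong (_+ t / u * u) (sym d≡t%u)))))
... | no d+uk≢t with d ≟ t % u | k ≟ t / u
...   | no _    | _       = refl
...   | yes _   | no _    = refl
...   | yes d≡ | yes k≡ = ⊥-elim (d+uk≢t (trans (cong₂ (λ a b → a + u * b) d≡ k≡)
          (trans (cong (t % u +_) (*-comm u (t / u))) (sym (m≡m%n+[m/n]*n t u)))))

subMod-* : ∀ c .{{_ : NonZero c}} n x y → subMod (c * n) (c * x) (c * y) ≡ c * subMod n x y
subMod-* c n x y with x <ᵇ y in e₁ | c * x <ᵇ c * y in e₂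
... | true  | true  = trans (cong (_∸ c * y) (sym (*-distribˡ-+ c x n))) (sym (*-distribˡ-∸ c (x + n) y))
... | false | false = sym (*-distribˡ-∸ c x y)
... | true  | false = contradiction (<⇒<ᵇ (*-monoʳ-< c (<ᵇ≡true⇒< {x} {y} e₁))) (subst T e₂)
... | false | true  = contradiction (<⇒<ᵇ (*-cancelˡ-< c x y (<ᵇ≡true⇒< {c * x} {c * y} e₂))) (subst T e₁)

𝟙-*≟ : ∀ c .{{_ : NonZero c}} a t → 𝟙 (c * a ≟ t) ≡ 𝟙 (c ∣? t) * 𝟙 (a ≟ t / c)
𝟙-*≟ c a t with c * a ≟ t
... | yes e = sym (cong₂ _*_ (𝟙-yes (c ∣? t) (divides a t≡ac))
                    (𝟙-yes (a ≟ t / c) (sym (trans (cong (_/ c) t≡ac) (m*n/n≡m a c)))))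
  where
  t≡ac : t ≡ a * c
  t≡ac = trans (sym e) (*-comm c a)
... | no ca≢t with c ∣? t
...   | no _ = refl
...   | yes (divides q t≡qc) with a ≟ t / c
...     | no _ = refl
...     | yes a≡ = contradiction
          (trans (cong (c *_) (trans a≡ (trans (cong (_/ c) t≡qc) (m*n/n≡m q c)))) (trans (*-comm c q) (sym t≡qc)))
          ca≢t

-- For i ≠ i' and a carry c ≤ 1, j ↦ j·i − (j·i' + c) is a bijection of Z₅; checked exhaustively.
rotation-hits-once : ∀ (i i' : Fin 5) → i ≢ i' → ∀ {c m} → c ≤ 1 → m < 5 →
  ∑[ j ∈ upTo 5 ] 𝟙 (subMod 5 ((j * toℕ i) % 5) ((j * toℕ i') % 5 + c) ≟ m) ≡ 1
rotation-hits-once i i' i≢i' {c} {m} c≤1 m<5 =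
  subst₂ (λ c m → ∑[ j ∈ upTo 5 ] 𝟙 (subMod 5 ((j * toℕ i) % 5) ((j * toℕ i') % 5 + c) ≟ m) ≡ 1)
    (toℕ-fromℕ< (s≤s c≤1)) (toℕ-fromℕ< m<5)
    (exhaustive i i' (fromℕ< (s≤s c≤1)) (fromℕ< m<5) i≢i')
  where
  exhaustive : ∀ (i i' : Fin 5) (c : Fin 2) (m : Fin 5) → i ≢ i' →
    ∑[ j ∈ upTo 5 ] 𝟙 (subMod 5 ((j * toℕ i) % 5) ((j * toℕ i') % 5 + toℕ c) ≟ toℕ m) ≡ 1
  exhaustive = from-yes (all? {5} λ i → all? {5} λ i' → all? {2} λ c → all? {5} λ m → ¬? (i ≟F i') →-dec
    (∑[ j ∈ upTo 5 ] 𝟙 (subMod 5 ((j * toℕ i) % 5) ((j * toℕ i') % 5 + toℕ c) ≟ toℕ m) ≟ 1))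

-- Labelled blocks and their differences

Labelled : ℕ → ℕ → Set
Labelled u v = Fin 5 × Elem u v

LBlock : ℕ → ℕ → Set
LBlock u v = List (Labelled u v)

module _ {u v : ℕ} where

  points : LBlock u v → List (Elem u v)
  points = map proj₂

  hits : Elem u v → Elem u v → ℕ × ℕ → ℕ
  hits x y t = 𝟙 (¬? (x ≟E y)) * 𝟙 (diff x y ≟ₚ t)

  multΔ : LBlock u v → ℕ × ℕ → ℕ
  multΔ Z t = ∑[ p ∈ Z ] ∑[ q ∈ Z ] hits (proj₂ p) (proj₂ q) t

  multΔs : List (LBlock u v) → ℕ × ℕ → ℕ
  multΔs 𝒵 t = ∑[ Z ∈ 𝒵 ] multΔ Z t

  ∑-Δ : ∀ (B : List (Elem u v)) t → ∑[ d ∈ Δ B ] 𝟙 (d ≟ₚ t) ≡ ∑[ x ∈ B ] ∑[ y ∈ B ] hits x y t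
  ∑-Δ B t = begin
    ∑[ d ∈ Δ B ] 𝟙 (d ≟ₚ t)
      ≡⟨ ∑-concatMap _ B _ ⟩
    ∑[ x ∈ B ] ∑[ d ∈ map (diff x) (filter (λ y → ¬? (x ≟E y)) B) ] 𝟙 (d ≟ₚ t)
      ≡⟨ ∑-cong B (λ x _ → ∑-map (diff x) (filter (λ y → ¬? (x ≟E y)) B) _) ⟩
    ∑[ x ∈ B ] ∑[ y ∈ filter (λ y → ¬? (x ≟E y)) B ] 𝟙 (diff x y ≟ₚ t)
      ≡⟨ ∑-cong B (λ x _ → ∑-filter (λ y → ¬? (x ≟E y)) B _) ⟩
    ∑[ x ∈ B ] ∑[ y ∈ B ] hits x y t ∎
    where open ≡-Reasoning

  count-Δ≡multΔs : ∀ (𝒵 : List (LBlock u v)) t →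
    length (filter (_≟ₚ t) (concatMap Δ (map points 𝒵))) ≡ multΔs 𝒵 t
  count-Δ≡multΔs 𝒵 t = begin
    length (filter (_≟ₚ t) (concatMap Δ (map points 𝒵)))
      ≡⟨ length-filter (_≟ₚ t) (concatMap Δ (map points 𝒵)) ⟩
    ∑[ d ∈ concatMap Δ (map points 𝒵) ] 𝟙 (d ≟ₚ t)
      ≡⟨ ∑-concatMap Δ (map points 𝒵) _ ⟩
    ∑[ B ∈ map points 𝒵 ] ∑[ d ∈ Δ B ] 𝟙 (d ≟ₚ t)
      ≡⟨ ∑-map points 𝒵 _ ⟩
    ∑[ Z ∈ 𝒵 ] ∑[ d ∈ Δ (points Z) ] 𝟙 (d ≟ₚ t)
      ≡⟨ ∑-cong 𝒵 (λ Z _ → trans (∑-Δ (points Z) t)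
           (trans (∑-map proj₂ Z _) (∑-cong Z (λ p _ → ∑-map proj₂ Z _)))) ⟩
    multΔs 𝒵 t ∎
    where open ≡-Reasoning

  WellLabelled : LBlock u v → Set
  WellLabelled Z = ∀ {p q} → p ∈ Z → q ∈ Z → proj₁ p ≡ proj₁ q ⇔ proj₂ p ≡ proj₂ q

  Sized : LBlock u v → Set
  Sized Z = length Z ≡ 4 ⊎ length Z ≡ 5

  countSize : ℕ → List (LBlock u v) → ℕ
  countSize k 𝒵 = ∑[ Z ∈ 𝒵 ] 𝟙 (length Z ≟ k)

record Family (u v : ℕ) : Set where
  field
    members  : List (LBlock u v)
    labelled : All WellLabelled members
    distinct : All (Unique ∘ points) members
    sized    : All Sized members
    balanced : countSize 4 members ≡ countSize 5 members
open Family

inLeave : ℕ → ℕ → ℕ × ℕ → ℕ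
inLeave α β (t₁ , t₂) = 𝟙 (5 ^ α ∣? t₁) * 𝟙 (5 ^ β ∣? t₂)

LeaveIs : ∀ {u v} → Family u v → ℕ → ℕ → Set
LeaveIs {u} {v} 𝔽 α β = ∀ {t₁ t₂} → t₁ < u → t₂ < v → multΔs (members 𝔽) (t₁ , t₂) + inLeave α β (t₁ , t₂) ≡ 1

record Packing (u v α β : ℕ) : Set where
  field
    family : Family u v
    leave  : LeaveIs family α β
open Packing

resize : ∀ {u v u' v' α β} → u ≡ u' → v ≡ v' → Packing u v α β → Packing u' v' α β
resize refl refl P = P

∅ : ∀ {u v} → Family u v
∅ = record { members = [] ; labelled = [] ; distinct = [] ; sized = [] ; balanced = refl }

trivialPacking : ∀ {u v} → Packing u v 0 0
trivialPacking = record
  { family = ∅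
  ; leave  = λ {t₁} {t₂} _ _ → cong₂ _*_ (𝟙-yes (1 ∣? t₁) (1∣ t₁)) (𝟙-yes (1 ∣? t₂) (1∣ t₂))
  }

_∪_ : ∀ {u v} → Family u v → Family u v → Family u v
𝔸 ∪ 𝔹 = record
  { members  = members 𝔸 ++ members 𝔹
  ; labelled = All.++⁺ (labelled 𝔸) (labelled 𝔹)
  ; distinct = All.++⁺ (distinct 𝔸) (distinct 𝔹)
  ; sized    = All.++⁺ (sized 𝔸) (sized 𝔹)
  ; balanced = trans (∑-++ (members 𝔸) (members 𝔹) _)
      (trans (cong₂ _+_ (balanced 𝔸) (balanced 𝔹)) (sym (∑-++ (members 𝔸) (members 𝔹) _)))
  }

multΔs-∪ : ∀ {u v} (𝔸 𝔹 : Family u v) t → multΔs (members (𝔸 ∪ 𝔹)) t ≡ multΔs (members 𝔸) t + multΔs (members 𝔹) t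
multΔs-∪ 𝔸 𝔹 t = ∑-++ (members 𝔸) (members 𝔹) _

module _ {u v U V : ℕ} (G : Labelled u v → Elem U V) where

  mapBlock : LBlock u v → LBlock U V
  mapBlock = map (λ p → proj₁ p , G p)

  length-mapBlock : ∀ Z → length (mapBlock Z) ≡ length Z
  length-mapBlock = length-map _

  sized-mapBlock : ∀ {Z} → Sized Z → Sized (mapBlock Z)
  sized-mapBlock {Z} (inj₁ e) = inj₁ (trans (length-mapBlock Z) e)
  sized-mapBlock {Z} (inj₂ e) = inj₂ (trans (length-mapBlock Z) e)

  countSize-mapBlock : ∀ k 𝒵 → countSize k (map mapBlock 𝒵) ≡ countSize k 𝒵
  countSize-mapBlock k 𝒵 =
    trans (∑-map mapBlock 𝒵 _) (∑-cong 𝒵 (λ Z _ → cong (λ n → 𝟙 (n ≟ k)) (length-mapBlock Z)))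

  module _ (G-inj : ∀ {p q} → G p ≡ G q → proj₂ p ≡ proj₂ q) where

    distinct-mapBlock : ∀ {Z} → Unique (points Z) → Unique (points (mapBlock Z))
    distinct-mapBlock {Z} uniq = subst Unique (map-∘ Z)
      (AllPairs.map⁺ (AllPairs.map (λ p≢q Gp≡Gq → p≢q (G-inj Gp≡Gq)) (AllPairs.map⁻ uniq)))

    wellLabelled-mapBlock : ∀ {Z} → WellLabelled Z → WellLabelled (mapBlock Z)
    wellLabelled-mapBlock wl p'∈ q'∈ with ∈-map⁻ _ p'∈ | ∈-map⁻ _ q'∈
    ... | p , p∈ , refl | q , q∈ , refl = mk⇔
      (λ i≡i' → cong G (cong₂ _,_ i≡i' (Equivalence.to (wl p∈ q∈) i≡i')))
      (λ Gp≡Gq → Equivalence.from (wl p∈ q∈) (G-inj Gp≡Gq))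

    multΔ-mapBlock : ∀ {Z} → WellLabelled Z → ∀ t →
      multΔ (mapBlock Z) t ≡ ∑[ p ∈ Z ] ∑[ q ∈ Z ] 𝟙 (¬? (proj₂ p ≟E proj₂ q)) * 𝟙 (diff (G p) (G q) ≟ₚ t)
    multΔ-mapBlock {Z} wl t = trans (∑-map _ Z _) (∑-cong Z λ p p∈ → trans (∑-map _ Z _) (∑-cong Z λ q q∈ →
      cong (_* 𝟙 (diff (G p) (G q) ≟ₚ t)) (𝟙-cong (¬? (G p ≟E G q)) (¬? (proj₂ p ≟E proj₂ q))
        (λ Gp≢Gq x≡y → Gp≢Gq (cong G (cong₂ _,_ (Equivalence.from (wl p∈ q∈) x≡y) x≡y)))
        (λ x≢y Gp≡Gq → x≢y (G-inj Gp≡Gq)))))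

module _ {u v U V : ℕ} (S : Elem u v → Elem U V) (S-inj : Injective _≡_ _≡_ S) where

  mapFamily : Family u v → Family U V
  mapFamily 𝔽 = record
    { members  = map (mapBlock (S ∘ proj₂)) (members 𝔽)
    ; labelled = All.map⁺ (All.map (wellLabelled-mapBlock (S ∘ proj₂) S-inj) (labelled 𝔽))
    ; distinct = All.map⁺ (All.map (distinct-mapBlock (S ∘ proj₂) S-inj) (distinct 𝔽))
    ; sized    = All.map⁺ (All.map (λ {Z} → sized-mapBlock (S ∘ proj₂) {Z}) (sized 𝔽))
    ; balanced = trans (countSize-mapBlock (S ∘ proj₂) 4 (members 𝔽))
        (trans (balanced 𝔽) (sym (countSize-mapBlock (S ∘ proj₂) 5 (members 𝔽))))
    }

  multΔs-mapFamily : ∀ 𝔽 {t t'} c → (∀ x y → 𝟙 (diff (S x) (S y) ≟ₚ t) ≡ c * 𝟙 (diff x y ≟ₚ t')) →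
    multΔs (members (mapFamily 𝔽)) t ≡ c * multΔs (members 𝔽) t'
  multΔs-mapFamily 𝔽 {t} {t'} c hit = begin
    multΔs (members (mapFamily 𝔽)) t
      ≡⟨ ∑-map _ (members 𝔽) _ ⟩
    ∑[ Z ∈ members 𝔽 ] multΔ (mapBlock (S ∘ proj₂) Z) t
      ≡⟨ ∑-cong (members 𝔽) (λ Z Z∈ → trans (multΔ-mapBlock (S ∘ proj₂) S-inj (All.lookup (labelled 𝔽) Z∈) t)
           (∑-cong Z λ p _ → ∑-cong Z λ q _ → cong (𝟙 (¬? (proj₂ p ≟E proj₂ q)) *_) (hit (proj₂ p) (proj₂ q)))) ⟩
    ∑[ Z ∈ members 𝔽 ] ∑[ p ∈ Z ] ∑[ q ∈ Z ] 𝟙 (¬? (proj₂ p ≟E proj₂ q)) * (c * 𝟙 (diff (proj₂ p) (proj₂ q) ≟ₚ t'))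
      ≡⟨ ∑-cong (members 𝔽) (λ Z _ → trans (∑-cong Z λ p _ → trans (∑-cong Z λ q _ → *-exchangeˡ (𝟙 (¬? (proj₂ p ≟E proj₂ q))) c _)
           (∑-*ˡ Z c _)) (∑-*ˡ Z c _)) ⟩
    ∑[ Z ∈ members 𝔽 ] c * multΔ Z t'
      ≡⟨ ∑-*ˡ (members 𝔽) c _ ⟩
    c * multΔs (members 𝔽) t' ∎
    where open ≡-Reasoning

module Lift {u U v : ℕ} .{{_ : NonZero u}} (U≡u*5 : U ≡ u * 5) where

  shift : ℕ → Fin 5 → Fin u → ℕ
  shift j i x = toℕ x + u * ((j * toℕ i) % 5)

  shift<U : ∀ j i x → shift j i x < U
  shift<U j i x = subst (shift j i x <_) (sym U≡u*5) (digits< (toℕ<n x) (m%n<n (j * toℕ i) 5))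

  shift%u : ∀ j i x → shift j i x % u ≡ toℕ x
  shift%u j i x = trans (cong (λ n → (toℕ x + n) % u) (*-comm u ((j * toℕ i) % 5)))
    (trans ([m+kn]%n≡m%n (toℕ x) ((j * toℕ i) % 5) u) (m<n⇒m%n≡m (toℕ<n x)))

  liftPoint : ℕ → Labelled u v → Elem U v
  liftPoint j (i , x , y) = fromℕ< (shift<U j i x) , y

  liftPoint-injective : ∀ j {p q} → liftPoint j p ≡ liftPoint j q → proj₂ p ≡ proj₂ q
  liftPoint-injective j {i , x , y} {i' , x' , y'} e = cong₂ _,_ (toℕ-injective (begin
    toℕ x                           ≡⟨ sym (shift%u j i x) ⟩
    shift j i x % u                 ≡⟨ cong (_% u) (sym (toℕ-fromℕ< (shift<U j i x))) ⟩
    toℕ (proj₁ (liftPoint j (i , x , y))) % u   ≡⟨ cong (λ z → toℕ (proj₁ z) % u) e ⟩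
    toℕ (proj₁ (liftPoint j (i' , x' , y'))) % u ≡⟨ cong (_% u) (toℕ-fromℕ< (shift<U j i' x')) ⟩
    shift j i' x' % u               ≡⟨ shift%u j i' x' ⟩
    toℕ x'                          ∎)) (cong proj₂ e)
    where open ≡-Reasoning

  liftBlocks : LBlock u v → List (LBlock U v)
  liftBlocks Z = map (λ j → mapBlock (liftPoint j) Z) (upTo 5)

  all-liftBlocks : ∀ {P : LBlock u v → Set} {Q : LBlock U v → Set} →
    (∀ {Z} → P Z → ∀ j → Q (mapBlock (liftPoint j) Z)) → ∀ {𝒵} → All P 𝒵 → All Q (concatMap liftBlocks 𝒵)
  all-liftBlocks h ps = All.concat⁺ (All.map⁺ (All.map (λ {Z} pZ →
    All.map⁺ {f = λ j → mapBlock (liftPoint j) Z} (All.applyUpTo⁺₂ id 5 (h pZ))) ps))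

  countSize-liftBlocks : ∀ k 𝒵 → countSize k (concatMap liftBlocks 𝒵) ≡ 5 * countSize k 𝒵
  countSize-liftBlocks k 𝒵 = trans (∑-concatMap liftBlocks 𝒵 _) (trans
    (∑-cong 𝒵 (λ Z _ → trans (∑-map (λ j → mapBlock (liftPoint j) Z) (upTo 5) (λ Z' → 𝟙 (length Z' ≟ k)))
      (∑-cong (upTo 5) (λ j _ → cong (λ n → 𝟙 (n ≟ k)) (length-mapBlock (liftPoint j) Z)))))
    (∑-*ˡ 𝒵 5 _))

  liftFamily : Family u v → Family U v
  liftFamily 𝔽 = record
    { members  = concatMap liftBlocks (members 𝔽)
    ; labelled = all-liftBlocks {P = WellLabelled} {Q = WellLabelled} (λ wl j → wellLabelled-mapBlock (liftPoint j) (liftPoint-injective j) wl) (labelled 𝔽)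
    ; distinct = all-liftBlocks {P = Unique ∘ points} {Q = Unique ∘ points} (λ d j → distinct-mapBlock (liftPoint j) (liftPoint-injective j) d) (distinct 𝔽)
    ; sized    = all-liftBlocks {P = Sized} {Q = Sized} (λ {Z} s j → sized-mapBlock (liftPoint j) {Z} s) (sized 𝔽)
    ; balanced = trans (countSize-liftBlocks 4 (members 𝔽))
        (trans (cong (5 *_) (balanced 𝔽)) (sym (countSize-liftBlocks 5 (members 𝔽))))
    }

  ∑-shift-hits : ∀ {i i'} → i ≢ i' → ∀ (x y : Fin u) {t} → t < U →
    ∑[ j ∈ upTo 5 ] 𝟙 (subMod U (shift j i x) (shift j i' y) ≟ t) ≡ 𝟙 (subMod u (toℕ x) (toℕ y) ≟ t % u)
  ∑-shift-hits {i} {i'} i≢i' x y {t} t<U = begin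
    ∑[ j ∈ upTo 5 ] 𝟙 (subMod U (shift j i x) (shift j i' y) ≟ t)
      ≡⟨ ∑-cong (upTo 5) (λ j _ → cong (λ n → 𝟙 (n ≟ t))
           (trans (cong (λ U → subMod U (shift j i x) (shift j i' y)) U≡u*5)
             (subMod-digits 5 (toℕ<n x) (toℕ<n y) (m%n<n (j * toℕ i) 5) (m%n<n (j * toℕ i') 5)))) ⟩
    ∑[ j ∈ upTo 5 ] 𝟙 (d + u * k j ≟ t)
      ≡⟨ ∑-cong (upTo 5) (λ j _ → 𝟙-digits u (k j) t (subMod<n u (toℕ x) (toℕ y) (toℕ<n x))) ⟩
    ∑[ j ∈ upTo 5 ] 𝟙 (d ≟ t % u) * 𝟙 (k j ≟ t / u)
      ≡⟨ ∑-*ˡ (upTo 5) (𝟙 (d ≟ t % u)) (λ j → 𝟙 (k j ≟ t / u)) ⟩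
    𝟙 (d ≟ t % u) * (∑[ j ∈ upTo 5 ] 𝟙 (k j ≟ t / u))
      ≡⟨ cong (𝟙 (d ≟ t % u) *_) (rotation-hits-once i i' i≢i' (borrow≤1 (toℕ x) (toℕ y))
           (m<n*o⇒m/o<n (subst (t <_) (trans U≡u*5 (*-comm u 5)) t<U))) ⟩
    𝟙 (d ≟ t % u) * 1
      ≡⟨ *-identityʳ _ ⟩
    𝟙 (d ≟ t % u) ∎
    where
    open ≡-Reasoning
    d = subMod u (toℕ x) (toℕ y)
    k : ℕ → ℕ
    k j = subMod 5 ((j * toℕ i) % 5) ((j * toℕ i') % 5 + borrow (toℕ x) (toℕ y))

  ∑-liftPoint-hits : ∀ {i i'} → i ≢ i' → ∀ (x y : Elem u v) {t₁ t₂} → t₁ < U →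
    ∑[ j ∈ upTo 5 ] 𝟙 (diff (liftPoint j (i , x)) (liftPoint j (i' , y)) ≟ₚ (t₁ , t₂)) ≡ 𝟙 (diff x y ≟ₚ (t₁ % u , t₂))
  ∑-liftPoint-hits {i} {i'} i≢i' (x₁ , x₂) (y₁ , y₂) {t₁} {t₂} t₁<U = begin
    ∑[ j ∈ upTo 5 ] 𝟙 (diff (liftPoint j (i , x₁ , x₂)) (liftPoint j (i' , y₁ , y₂)) ≟ₚ (t₁ , t₂))
      ≡⟨ ∑-cong (upTo 5) (λ j _ → trans (𝟙-≟ₚ (subMod U (lifted j i x₁) (lifted j i' y₁)) _ t₁ t₂)
           (cong₂ (λ a b → 𝟙 (subMod U a b ≟ t₁) * c)
           (toℕ-fromℕ< (shift<U j i x₁)) (toℕ-fromℕ< (shift<U j i' y₁)))) ⟩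
    ∑[ j ∈ upTo 5 ] 𝟙 (subMod U (shift j i x₁) (shift j i' y₁) ≟ t₁) * c
      ≡⟨ ∑-*ʳ (upTo 5) c (λ j → 𝟙 (subMod U (shift j i x₁) (shift j i' y₁) ≟ t₁)) ⟩
    (∑[ j ∈ upTo 5 ] 𝟙 (subMod U (shift j i x₁) (shift j i' y₁) ≟ t₁)) * c
      ≡⟨ cong (_* c) (∑-shift-hits i≢i' x₁ y₁ t₁<U) ⟩
    𝟙 (subMod u (toℕ x₁) (toℕ y₁) ≟ t₁ % u) * c
      ≡⟨ sym (𝟙-≟ₚ _ _ (t₁ % u) t₂) ⟩
    𝟙 (diff (x₁ , x₂) (y₁ , y₂) ≟ₚ (t₁ % u , t₂)) ∎
    where
    open ≡-Reasoning
    c = 𝟙 (subMod v (toℕ x₂) (toℕ y₂) ≟ t₂)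
    lifted : ℕ → Fin 5 → Fin u → ℕ
    lifted j i x = toℕ (fromℕ< (shift<U j i x))

  ∑-lift-hits : ∀ (p q : Labelled u v) → (proj₁ p ≡ proj₁ q → proj₂ p ≡ proj₂ q) → ∀ {t₁ t₂} → t₁ < U →
    ∑[ j ∈ upTo 5 ] 𝟙 (¬? (proj₂ p ≟E proj₂ q)) * 𝟙 (diff (liftPoint j p) (liftPoint j q) ≟ₚ (t₁ , t₂))
      ≡ 𝟙 (¬? (proj₂ p ≟E proj₂ q)) * 𝟙 (diff (proj₂ p) (proj₂ q) ≟ₚ (t₁ % u , t₂))
  ∑-lift-hits p q same-label {t₁} {t₂} t₁<U with proj₂ p ≟E proj₂ q
  ... | yes _   = ∑-zero (upTo 5)
  ... | no x≢y = trans (∑-*ˡ (upTo 5) 1 (λ j → 𝟙 (diff (liftPoint j p) (liftPoint j q) ≟ₚ (t₁ , t₂))))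
                   (cong (1 *_) (∑-liftPoint-hits (x≢y ∘ same-label) (proj₂ p) (proj₂ q) t₁<U))

  ∑-multΔ-liftBlocks : ∀ {Z} → WellLabelled Z → ∀ {t₁ t₂} → t₁ < U →
    ∑[ Z' ∈ liftBlocks Z ] multΔ Z' (t₁ , t₂) ≡ multΔ Z (t₁ % u , t₂)
  ∑-multΔ-liftBlocks {Z} wl {t₁} {t₂} t₁<U = begin
    ∑[ Z' ∈ liftBlocks Z ] multΔ Z' (t₁ , t₂)
      ≡⟨ ∑-map (λ j → mapBlock (liftPoint j) Z) (upTo 5) (λ Z' → multΔ Z' (t₁ , t₂)) ⟩
    ∑[ j ∈ upTo 5 ] multΔ (mapBlock (liftPoint j) Z) (t₁ , t₂)
      ≡⟨ ∑-cong (upTo 5) (λ j _ → multΔ-mapBlock (liftPoint j) (liftPoint-injective j) wl (t₁ , t₂)) ⟩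
    ∑[ j ∈ upTo 5 ] ∑[ p ∈ Z ] ∑[ q ∈ Z ] H j p q
      ≡⟨ ∑-comm (upTo 5) Z (λ j p → ∑[ q ∈ Z ] H j p q) ⟩
    ∑[ p ∈ Z ] ∑[ j ∈ upTo 5 ] ∑[ q ∈ Z ] H j p q
      ≡⟨ ∑-cong Z (λ p _ → ∑-comm (upTo 5) Z (λ j q → H j p q)) ⟩
    ∑[ p ∈ Z ] ∑[ q ∈ Z ] ∑[ j ∈ upTo 5 ] H j p q
      ≡⟨ ∑-cong Z (λ p p∈ → ∑-cong Z (λ q q∈ → ∑-lift-hits p q (Equivalence.to (wl p∈ q∈)) t₁<U)) ⟩
    multΔ Z (t₁ % u , t₂) ∎
    where
    open ≡-Reasoning
    H : ℕ → Labelled u v → Labelled u v → ℕ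
    H j p q = 𝟙 (¬? (proj₂ p ≟E proj₂ q)) * 𝟙 (diff (liftPoint j p) (liftPoint j q) ≟ₚ (t₁ , t₂))

  multΔs-liftFamily : ∀ 𝔽 {t₁ t₂} → t₁ < U → multΔs (members (liftFamily 𝔽)) (t₁ , t₂) ≡ multΔs (members 𝔽) (t₁ % u , t₂)
  multΔs-liftFamily 𝔽 t₁<U = trans (∑-concatMap liftBlocks (members 𝔽) _)
    (∑-cong (members 𝔽) (λ Z Z∈ → ∑-multΔ-liftBlocks (All.lookup (labelled 𝔽) Z∈) t₁<U))

module Scale {w v' U V : ℕ} (c d : ℕ) .{{_ : NonZero c}} .{{_ : NonZero d}} (U≡c*w : U ≡ c * w) (V≡d*v' : V ≡ d * v') where

  private
    c*x<U : (x : Fin w) → c * toℕ x < U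
    c*x<U x = subst (c * toℕ x <_) (sym U≡c*w) (*-monoʳ-< c (toℕ<n x))

    d*y<V : (y : Fin v') → d * toℕ y < V
    d*y<V y = subst (d * toℕ y <_) (sym V≡d*v') (*-monoʳ-< d (toℕ<n y))

  scalePoint : Elem w v' → Elem U V
  scalePoint (x , y) = fromℕ< (c*x<U x) , fromℕ< (d*y<V y)

  scalePoint-injective : Injective _≡_ _≡_ scalePoint
  scalePoint-injective {x , y} {x' , y'} e = cong₂ _,_
    (toℕ-injective (*-cancelˡ-≡ (toℕ x) (toℕ x') c
      (trans (sym (toℕ-fromℕ< (c*x<U x))) (trans (cong (toℕ ∘ proj₁) e) (toℕ-fromℕ< (c*x<U x'))))))
    (toℕ-injective (*-cancelˡ-≡ (toℕ y) (toℕ y') d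
      (trans (sym (toℕ-fromℕ< (d*y<V y))) (trans (cong (toℕ ∘ proj₂) e) (toℕ-fromℕ< (d*y<V y'))))))

  diff-scalePoint : ∀ a b → diff (scalePoint a) (scalePoint b) ≡ (c * proj₁ (diff a b) , d * proj₂ (diff a b))
  diff-scalePoint (x , y) (x' , y') = cong₂ _,_
    (trans (cong₂ (subMod U) (toℕ-fromℕ< (c*x<U x)) (toℕ-fromℕ< (c*x<U x')))
      (trans (cong (λ n → subMod n (c * toℕ x) (c * toℕ x')) U≡c*w) (subMod-* c w (toℕ x) (toℕ x'))))
    (trans (cong₂ (subMod V) (toℕ-fromℕ< (d*y<V y)) (toℕ-fromℕ< (d*y<V y')))
      (trans (cong (λ n → subMod n (d * toℕ y) (d * toℕ y')) V≡d*v') (subMod-* d v' (toℕ y) (toℕ y'))))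

  𝟙-diff-scalePoint : ∀ a b t₁ t₂ → 𝟙 (diff (scalePoint a) (scalePoint b) ≟ₚ (t₁ , t₂))
                        ≡ 𝟙 (c ∣? t₁) * 𝟙 (d ∣? t₂) * 𝟙 (diff a b ≟ₚ (t₁ / c , t₂ / d))
  𝟙-diff-scalePoint a b t₁ t₂ = begin
    𝟙 (diff (scalePoint a) (scalePoint b) ≟ₚ (t₁ , t₂))
      ≡⟨ cong (λ z → 𝟙 (z ≟ₚ (t₁ , t₂))) (diff-scalePoint a b) ⟩
    𝟙 ((c * δ₁ , d * δ₂) ≟ₚ (t₁ , t₂))
      ≡⟨ 𝟙-≟ₚ _ _ t₁ t₂ ⟩
    𝟙 (c * δ₁ ≟ t₁) * 𝟙 (d * δ₂ ≟ t₂)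
      ≡⟨ cong₂ _*_ (𝟙-*≟ c δ₁ t₁) (𝟙-*≟ d δ₂ t₂) ⟩
    𝟙 (c ∣? t₁) * 𝟙 (δ₁ ≟ t₁ / c) * (𝟙 (d ∣? t₂) * 𝟙 (δ₂ ≟ t₂ / d))
      ≡⟨ *-interchange (𝟙 (c ∣? t₁)) _ _ _ ⟩
    𝟙 (c ∣? t₁) * 𝟙 (d ∣? t₂) * (𝟙 (δ₁ ≟ t₁ / c) * 𝟙 (δ₂ ≟ t₂ / d))
      ≡⟨ cong (𝟙 (c ∣? t₁) * 𝟙 (d ∣? t₂) *_) (sym (𝟙-≟ₚ δ₁ δ₂ (t₁ / c) (t₂ / d))) ⟩
    𝟙 (c ∣? t₁) * 𝟙 (d ∣? t₂) * 𝟙 (diff a b ≟ₚ (t₁ / c , t₂ / d)) ∎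
    where
    open ≡-Reasoning
    δ₁ = proj₁ (diff a b)
    δ₂ = proj₂ (diff a b)

  scaleFamily : Family w v' → Family U V
  scaleFamily = mapFamily scalePoint scalePoint-injective

  multΔs-scaleFamily : ∀ 𝔽 t₁ t₂ → multΔs (members (scaleFamily 𝔽)) (t₁ , t₂)
                         ≡ 𝟙 (c ∣? t₁) * 𝟙 (d ∣? t₂) * multΔs (members 𝔽) (t₁ / c , t₂ / d)
  multΔs-scaleFamily 𝔽 t₁ t₂ =
    multΔs-mapFamily scalePoint scalePoint-injective 𝔽 (𝟙 (c ∣? t₁) * 𝟙 (d ∣? t₂)) (λ a b → 𝟙-diff-scalePoint a b t₁ t₂)

swapFamily : ∀ {u v} → Family u v → Family v u
swapFamily = mapFamily swap (cong swap)

multΔs-swapFamily : ∀ {u v} (𝔽 : Family u v) t₁ t₂ →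
  multΔs (members (swapFamily 𝔽)) (t₁ , t₂) ≡ multΔs (members 𝔽) (t₂ , t₁)
multΔs-swapFamily 𝔽 t₁ t₂ = trans (multΔs-mapFamily swap (cong swap) 𝔽 1 hit) (*-identityˡ _)
  where
  hit : ∀ x y → 𝟙 (diff (swap x) (swap y) ≟ₚ (t₁ , t₂)) ≡ 1 * 𝟙 (diff x y ≟ₚ (t₂ , t₁))
  hit x y = begin
    𝟙 ((δ₂ , δ₁) ≟ₚ (t₁ , t₂))    ≡⟨ 𝟙-≟ₚ δ₂ δ₁ t₁ t₂ ⟩
    𝟙 (δ₂ ≟ t₁) * 𝟙 (δ₁ ≟ t₂)    ≡⟨ *-comm (𝟙 (δ₂ ≟ t₁)) _ ⟩
    𝟙 (δ₁ ≟ t₂) * 𝟙 (δ₂ ≟ t₁)    ≡⟨ sym (𝟙-≟ₚ δ₁ δ₂ t₂ t₁) ⟩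
    𝟙 (diff x y ≟ₚ (t₂ , t₁))     ≡⟨ sym (*-identityˡ _) ⟩
    1 * 𝟙 (diff x y ≟ₚ (t₂ , t₁)) ∎
    where
    open ≡-Reasoning
    δ₁ = proj₁ (diff x y)
    δ₂ = proj₂ (diff x y)

-- Growing packings

swapPacking : ∀ {u v α β} → Packing u v α β → Packing v u β α
swapPacking {α = α} {β} P = record
  { family = swapFamily (family P)
  ; leave  = λ {t₁} {t₂} t₁<v t₂<u → trans
      (cong₂ _+_ (multΔs-swapFamily (family P) t₁ t₂) (*-comm (𝟙 (5 ^ β ∣? t₁)) (𝟙 (5 ^ α ∣? t₂))))
      (leave P t₂<u t₁<v)
  }

𝟙-∣?-% : ∀ {d u} .{{_ : NonZero u}} → d ∣ u → ∀ t → 𝟙 (d ∣? t) ≡ 𝟙 (d ∣? t % u)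
𝟙-∣?-% {d} {u} d∣u t = 𝟙-cong (d ∣? t) (d ∣? t % u) (λ d∣t → %-presˡ-∣ d∣t d∣u) (∣n∣m%n⇒∣m d∣u)

liftPacking : ∀ {u U v α β} .{{_ : NonZero u}} → U ≡ u * 5 → 5 ^ α ∣ u → Packing u v α β → Packing U v α β
liftPacking {u} {U} {v} {α} {β} U≡u*5 5^α∣u P = record
  { family = liftFamily (family P)
  ; leave  = λ {t₁} {t₂} t₁<U t₂<v → trans
      (cong₂ _+_ (multΔs-liftFamily (family P) t₁<U) (cong (_* 𝟙 (5 ^ β ∣? t₂)) (𝟙-∣?-% 5^α∣u t₁)))
      (leave P (m%n<n t₁ u) t₂<v)
  }
  where open Lift {u} {U} {v} U≡u*5

-- If the old leave is {A ∧ B}, the added blocks cover {A ∧ B ∧ ¬C} and S ⇔ A ∧ C, the new leave is {S ∧ B}.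
𝟙-refine : ∀ {a b s c} {A : Set a} {B : Set b} {S : Set s} {C : Set c}
  (A? : Dec A) (B? : Dec B) (S? : Dec S) (C? : Dec C) {m n} →
  (S → A) → (A → S → C) → (A → C → S) → m + 𝟙 A? * 𝟙 B? ≡ 1 → n + 𝟙 C? ≡ 1 →
  m + 𝟙 A? * 𝟙 B? * n + 𝟙 S? * 𝟙 B? ≡ 1
𝟙-refine (no ¬a) B? S? C? {m} S⇒A _ _ m+0≡1 _ = begin
  m + 0 + 𝟙 S? * 𝟙 B? ≡⟨ cong (λ z → m + 0 + z * 𝟙 B?) (𝟙-cong S? (no ¬a) S⇒A (⊥-elim ∘ ¬a)) ⟩
  m + 0 + 0            ≡⟨ +-identityʳ (m + 0) ⟩
  m + 0                ≡⟨ m+0≡1 ⟩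
  1                    ∎
  where open ≡-Reasoning
𝟙-refine (yes _) (no _) S? C? {m} _ _ _ m+0≡1 _ =
  trans (cong (m + 0 +_) (*-zeroʳ (𝟙 S?))) (trans (+-identityʳ (m + 0)) m+0≡1)
𝟙-refine (yes a) (yes _) S? C? {m} {n} _ S⇒C C⇒S m+1≡1 n+C≡1 = begin
  m + 1 * n + 𝟙 S? * 1 ≡⟨ cong₂ (λ x y → x + 1 * n + y) (+-cancelʳ-≡ 1 m 0 m+1≡1) (*-identityʳ (𝟙 S?)) ⟩
  1 * n + 𝟙 S?         ≡⟨ cong₂ _+_ (*-identityˡ n) (𝟙-cong S? C? (S⇒C a) (C⇒S a)) ⟩
  n + 𝟙 C?             ≡⟨ n+C≡1 ⟩
  1                    ∎
  where open ≡-Reasoning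

-- Lift T from Z_u to Z_{5u}, then cover 5^α Z_{5u} ∖ 5^{α+1} Z_{5u} by the 5^α-multiple of W.
extend₁ : ∀ {m n α β} .{{_ : NonZero m}} → Packing (m * 5 ^ α) (n * 5 ^ β) α β → Packing (m * 5) n 1 0 →
          Packing (m * 5 ^ suc α) (n * 5 ^ β) (suc α) β
extend₁ {m} {n} {α} {β} T W = record { family = 𝔽 ; leave = leave𝔽 }
  where
  instance
    5^α≢0 : NonZero (5 ^ α)
    5^α≢0 = m^n≢0 5 α
    5^β≢0 : NonZero (5 ^ β)
    5^β≢0 = m^n≢0 5 β
    u≢0 : NonZero (m * 5 ^ α)
    u≢0 = m*n≢0 m (5 ^ α)

  u = m * 5 ^ α
  U = m * 5 ^ suc α

  U≡u*5 : U ≡ u * 5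
  U≡u*5 = trans (cong (m *_) (*-comm 5 (5 ^ α))) (sym (*-assoc m (5 ^ α) 5))

  U≡m*5*5^α : U ≡ m * 5 * 5 ^ α
  U≡m*5*5^α = sym (*-assoc m 5 (5 ^ α))

  open Lift {u} {U} {n * 5 ^ β} U≡u*5
  open Scale {m * 5} {n} {U} {n * 5 ^ β} (5 ^ α) (5 ^ β) (trans U≡m*5*5^α (*-comm (m * 5) (5 ^ α))) (*-comm n (5 ^ β))

  𝔽 = liftFamily (family T) ∪ scaleFamily (family W)

  leave𝔽 : LeaveIs 𝔽 (suc α) β
  leave𝔽 {t₁} {t₂} t₁<U t₂<v = begin
    multΔs (members 𝔽) (t₁ , t₂) + inLeave (suc α) β (t₁ , t₂)
      ≡⟨ cong (_+ inLeave (suc α) β (t₁ , t₂)) (trans (multΔs-∪ (liftFamily (family T)) (scaleFamily (family W)) (t₁ , t₂))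
           (cong₂ _+_ (multΔs-liftFamily (family T) t₁<U) (multΔs-scaleFamily (family W) t₁ t₂))) ⟩
    multΔs (members (family T)) (t₁ % u , t₂) + inLeave α β (t₁ , t₂) * multΔs (members (family W)) (t₁ / 5 ^ α , t₂ / 5 ^ β)
      + inLeave (suc α) β (t₁ , t₂)
      ≡⟨ 𝟙-refine (5 ^ α ∣? t₁) (5 ^ β ∣? t₂) (5 ^ suc α ∣? t₁) (5 ∣? t₁ / 5 ^ α)
           (∣-trans (n∣m*n 5)) (λ _ → m*n∣o⇒m∣o/n 5 (5 ^ α)) m∣n/o⇒m*o∣n leaveT leaveW ⟩
    1 ∎
    where
    open ≡-Reasoning
    leaveT : multΔs (members (family T)) (t₁ % u , t₂) + inLeave α β (t₁ , t₂) ≡ 1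
    leaveT = trans (cong (λ z → multΔs (members (family T)) (t₁ % u , t₂) + z * 𝟙 (5 ^ β ∣? t₂)) (𝟙-∣?-% (n∣m*n m) t₁))
               (leave T (m%n<n t₁ u) t₂<v)
    leaveW : multΔs (members (family W)) (t₁ / 5 ^ α , t₂ / 5 ^ β) + 𝟙 (5 ∣? t₁ / 5 ^ α) ≡ 1
    leaveW = trans (cong (multΔs (members (family W)) (t₁ / 5 ^ α , t₂ / 5 ^ β) +_)
                       (sym (trans (cong (𝟙 (5 ∣? t₁ / 5 ^ α) *_) (𝟙-yes (1 ∣? t₂ / 5 ^ β) (1∣ _)))
                                   (*-identityʳ (𝟙 (5 ∣? t₁ / 5 ^ α))))))
               (leave W (m<n*o⇒m/o<n (subst (t₁ <_) U≡m*5*5^α t₁<U)) (m<n*o⇒m/o<n t₂<v))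

extend₂ : ∀ {m n α β} .{{_ : NonZero m}} → Packing (n * 5 ^ β) (m * 5 ^ α) β α → Packing n (m * 5) 0 1 →
          Packing (n * 5 ^ β) (m * 5 ^ suc α) β (suc α)
extend₂ T W = swapPacking (extend₁ (swapPacking T) (swapPacking W))

packing⇒BDP45 : ∀ {u v s t α β} .{{_ : NonZero s}} .{{_ : NonZero t}} →
  Packing u v α β → u / s ≡ 5 ^ α → v / t ≡ 5 ^ β → BDP45 u v s t
packing⇒BDP45 {u} {v} {s} {t} {α} {β} P u/s≡5^α v/t≡5^β = record
  { blocks   = map points (members 𝔽)
  ; distinct = All.map⁺ (distinct 𝔽)
  ; sizes    = All.map⁺ (All.map (λ {Z} → sized-points Z) (sized 𝔽))
  ; balanced = trans (countSize-points 4) (trans (balanced 𝔽) (sym (countSize-points 5)))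
  ; packing  = λ g → m+n≤o⇒m≤o _ (≤-reflexive (mult+inLeave≡1 g))
  ; leave    = λ g → leave⇒inSub g , inSub⇒leave g
  }
  where
  𝔽 = family P

  sized-points : ∀ Z → Sized Z → length (points Z) ≡ 4 ⊎ length (points Z) ≡ 5
  sized-points Z (inj₁ e) = inj₁ (trans (length-map proj₂ Z) e)
  sized-points Z (inj₂ e) = inj₂ (trans (length-map proj₂ Z) e)

  countSize-points : ∀ k → numOfSize k (map points (members 𝔽)) ≡ countSize k (members 𝔽)
  countSize-points k = trans (length-filter _ (map points (members 𝔽))) (trans (∑-map points (members 𝔽) _)
    (∑-cong (members 𝔽) (λ Z _ → cong (λ n → 𝟙 (n ≟ k)) (length-map proj₂ Z))))

  mult+inLeave≡1 : ∀ (g : Elem u v) → mult (map points (members 𝔽)) g + inLeave α β (toℕ (proj₁ g) , toℕ (proj₂ g)) ≡ 1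
  mult+inLeave≡1 (g₁ , g₂) = trans (cong (_+ inLeave α β (toℕ g₁ , toℕ g₂)) (count-Δ≡multΔs (members 𝔽) (toℕ g₁ , toℕ g₂)))
    (leave P (toℕ<n g₁) (toℕ<n g₂))

  leave⇒inSub : ∀ (g : Elem u v) → mult (map points (members 𝔽)) g ≡ 0 → InSub {u} {v} s t g
  leave⇒inSub (g₁ , g₂) mult≡0 with 𝟙*𝟙≡1 (5 ^ α ∣? toℕ g₁) (5 ^ β ∣? toℕ g₂)
    (trans (cong (_+ inLeave α β (toℕ g₁ , toℕ g₂)) (sym mult≡0)) (mult+inLeave≡1 (g₁ , g₂)))
  ... | d₁ , d₂ = subst (_∣ toℕ g₁) (sym u/s≡5^α) d₁ , subst (_∣ toℕ g₂) (sym v/t≡5^β) d₂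

  inSub⇒leave : ∀ (g : Elem u v) → InSub {u} {v} s t g → mult (map points (members 𝔽)) g ≡ 0
  inSub⇒leave (g₁ , g₂) (d₁ , d₂) = +-cancelʳ-≡ 1 _ 0 (trans (cong (mult (map points (members 𝔽)) (g₁ , g₂) +_) (sym inLeave≡1))
    (mult+inLeave≡1 (g₁ , g₂)))
    where
    inLeave≡1 : inLeave α β (toℕ g₁ , toℕ g₂) ≡ 1
    inLeave≡1 = cong₂ _*_ (𝟙-yes (5 ^ α ∣? toℕ g₁) (subst (_∣ toℕ g₁) u/s≡5^α d₁))
                          (𝟙-yes (5 ^ β ∣? toℕ g₂) (subst (_∣ toℕ g₂) v/t≡5^β d₂))

-- Base packings

module Certificate {u v : ℕ} .{{_ : NonZero u}} .{{_ : NonZero v}} where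

  labelFrom : ℕ → List (ℕ × ℕ) → LBlock u v
  labelFrom k []             = []
  labelFrom k ((x , y) ∷ ps) = (k mod 5 , x mod u , y mod v) ∷ labelFrom (suc k) ps

  LabelsMatch : LBlock u v → Set
  LabelsMatch Z = All (λ p → All (λ q → (proj₁ p ≡ proj₁ q → proj₂ p ≡ proj₂ q) × (proj₂ p ≡ proj₂ q → proj₁ p ≡ proj₁ q)) Z) Z

  labelsMatch? : ∀ Z → Dec (LabelsMatch Z)
  labelsMatch? Z = All.all? (λ p → All.all? (λ q → ((proj₁ p ≟F proj₁ q) →-dec (proj₂ p ≟E proj₂ q))
                                                  ×-dec ((proj₂ p ≟E proj₂ q) →-dec (proj₁ p ≟F proj₁ q))) Z) Z

  Valid : List (LBlock u v) → ℕ → ℕ → Set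
  Valid 𝒵 α β = All LabelsMatch 𝒵 × All (Unique ∘ points) 𝒵 × All Sized 𝒵 × countSize 4 𝒵 ≡ countSize 5 𝒵
    × All (λ t₁ → All (λ t₂ → length (filter (_≟ₚ (t₁ , t₂)) (concatMap Δ (map points 𝒵))) + inLeave α β (t₁ , t₂) ≡ 1)
                      (upTo v)) (upTo u)

  valid? : ∀ 𝒵 α β → Dec (Valid 𝒵 α β)
  valid? 𝒵 α β =
    All.all? labelsMatch? 𝒵
    ×-dec All.all? (λ Z → AllPairs.allPairs? (λ x y → ¬? (x ≟E y)) (points Z)) 𝒵
    ×-dec All.all? (λ Z → (length Z ≟ 4) ⊎-dec (length Z ≟ 5)) 𝒵
    ×-dec (countSize 4 𝒵 ≟ countSize 5 𝒵)
    ×-dec All.all? (λ t₁ → All.all? (λ t₂ →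
            length (filter (_≟ₚ (t₁ , t₂)) (concatMap Δ (map points 𝒵))) + inLeave α β (t₁ , t₂) ≟ 1) (upTo v)) (upTo u)

  validPacking : ∀ 𝒵 {α β} → Valid 𝒵 α β → Packing u v α β
  validPacking 𝒵 {α} {β} (match , uniq , sizes , bal , grid) = record
    { family = record
      { members  = 𝒵
      ; labelled = All.map (λ m {p} {q} p∈ q∈ → uncurry mk⇔ (All.lookup (All.lookup m p∈) q∈)) match
      ; distinct = uniq
      ; sized    = sizes
      ; balanced = bal
      }
    ; leave = λ {t₁} {t₂} t₁<u t₂<v → trans (cong (_+ inLeave α β (t₁ , t₂)) (sym (count-Δ≡multΔs 𝒵 (t₁ , t₂))))
        (All.lookup (All.lookup grid (∈-upTo⁺ t₁<u)) (∈-upTo⁺ t₂<v))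
    }

open Certificate

base-4×120 : Packing 4 120 0 1
base-4×120 = validPacking blocks (from-yes (valid? blocks 0 1))
  where
  blocks : List (LBlock 4 120)
  blocks = map (labelFrom 0) (
    ((0 , 0) ∷ (0 , 31) ∷ (2 , 42) ∷ (3 , 18) ∷ (3 , 29) ∷ []) ∷
    ((0 , 0) ∷ (0 , 79) ∷ (2 , 18) ∷ (3 , 42) ∷ (3 , 101) ∷ []) ∷
    ((0 , 0) ∷ (0 , 101) ∷ (1 , 97) ∷ (0 , 83) ∷ (3 , 9) ∷ []) ∷
    ((0 , 0) ∷ (0 , 29) ∷ (1 , 73) ∷ (0 , 107) ∷ (3 , 81) ∷ []) ∷
    ((0 , 0) ∷ (0 , 106) ∷ (1 , 47) ∷ (1 , 53) ∷ (3 , 19) ∷ []) ∷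
    ((0 , 0) ∷ (0 , 34) ∷ (1 , 23) ∷ (1 , 77) ∷ (3 , 91) ∷ []) ∷
    ((0 , 0) ∷ (2 , 101) ∷ (1 , 17) ∷ (3 , 8) ∷ (2 , 69) ∷ []) ∷
    ((0 , 0) ∷ (2 , 29) ∷ (1 , 113) ∷ (3 , 32) ∷ (2 , 21) ∷ []) ∷
    ((0 , 0) ∷ (1 , 106) ∷ (2 , 7) ∷ (3 , 48) ∷ (3 , 69) ∷ []) ∷
    ((0 , 0) ∷ (1 , 34) ∷ (2 , 103) ∷ (3 , 72) ∷ (3 , 21) ∷ []) ∷
    ((0 , 0) ∷ (0 , 1) ∷ (0 , 117) ∷ (1 , 118) ∷ (0 , 64) ∷ []) ∷
    ((0 , 0) ∷ (0 , 49) ∷ (0 , 93) ∷ (1 , 22) ∷ (0 , 16) ∷ []) ∷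
    ((0 , 0) ∷ (2 , 76) ∷ (1 , 12) ∷ (2 , 93) ∷ []) ∷
    ((0 , 0) ∷ (2 , 4) ∷ (1 , 108) ∷ (2 , 117) ∷ []) ∷
    ((0 , 0) ∷ (3 , 1) ∷ (1 , 7) ∷ (2 , 63) ∷ []) ∷
    ((0 , 0) ∷ (3 , 49) ∷ (1 , 103) ∷ (2 , 87) ∷ []) ∷
    ((0 , 0) ∷ (0 , 81) ∷ (2 , 97) ∷ (1 , 18) ∷ []) ∷
    ((0 , 0) ∷ (0 , 9) ∷ (2 , 73) ∷ (1 , 42) ∷ []) ∷
    ((0 , 0) ∷ (1 , 76) ∷ (2 , 2) ∷ (1 , 8) ∷ []) ∷
    ((0 , 0) ∷ (1 , 4) ∷ (2 , 98) ∷ (1 , 32) ∷ []) ∷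
    ((0 , 0) ∷ (2 , 46) ∷ (0 , 82) ∷ (2 , 108) ∷ []) ∷
    ((0 , 0) ∷ (0 , 46) ∷ (0 , 22) ∷ (0 , 48) ∷ []) ∷
    ((0 , 0) ∷ (2 , 71) ∷ (0 , 47) ∷ (2 , 48) ∷ []) ∷
    ((0 , 0) ∷ (2 , 31) ∷ (2 , 67) ∷ (0 , 108) ∷ []) ∷ [])

base-20×24 : Packing 20 24 1 0
base-20×24 = validPacking blocks (from-yes (valid? blocks 1 0))
  where
  blocks : List (LBlock 20 24)
  blocks = map (labelFrom 0) (
    ((0 , 0) ∷ (16 , 7) ∷ (2 , 18) ∷ (3 , 18) ∷ (19 , 5) ∷ []) ∷
    ((0 , 0) ∷ (4 , 7) ∷ (18 , 18) ∷ (7 , 18) ∷ (11 , 5) ∷ []) ∷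
    ((0 , 0) ∷ (16 , 5) ∷ (17 , 1) ∷ (8 , 11) ∷ (19 , 9) ∷ []) ∷
    ((0 , 0) ∷ (4 , 5) ∷ (13 , 1) ∷ (12 , 11) ∷ (11 , 9) ∷ []) ∷
    ((0 , 0) ∷ (16 , 10) ∷ (17 , 23) ∷ (13 , 5) ∷ (19 , 19) ∷ []) ∷
    ((0 , 0) ∷ (4 , 10) ∷ (13 , 23) ∷ (17 , 5) ∷ (11 , 19) ∷ []) ∷
    ((0 , 0) ∷ (6 , 5) ∷ (17 , 17) ∷ (3 , 8) ∷ (14 , 21) ∷ []) ∷
    ((0 , 0) ∷ (14 , 5) ∷ (13 , 17) ∷ (7 , 8) ∷ (6 , 21) ∷ []) ∷
    ((0 , 0) ∷ (1 , 10) ∷ (2 , 7) ∷ (3 , 0) ∷ (19 , 21) ∷ []) ∷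
    ((0 , 0) ∷ (9 , 10) ∷ (18 , 7) ∷ (7 , 0) ∷ (11 , 21) ∷ []) ∷
    ((0 , 0) ∷ (16 , 1) ∷ (12 , 21) ∷ (13 , 22) ∷ (4 , 16) ∷ []) ∷
    ((0 , 0) ∷ (4 , 1) ∷ (8 , 21) ∷ (17 , 22) ∷ (16 , 16) ∷ []) ∷
    ((0 , 0) ∷ (6 , 4) ∷ (17 , 12) ∷ (18 , 21) ∷ []) ∷
    ((0 , 0) ∷ (14 , 4) ∷ (13 , 12) ∷ (2 , 21) ∷ []) ∷
    ((0 , 0) ∷ (11 , 1) ∷ (17 , 7) ∷ (18 , 15) ∷ []) ∷
    ((0 , 0) ∷ (19 , 1) ∷ (13 , 7) ∷ (2 , 15) ∷ []) ∷
    ((0 , 0) ∷ (16 , 9) ∷ (2 , 1) ∷ (13 , 18) ∷ []) ∷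
    ((0 , 0) ∷ (4 , 9) ∷ (18 , 1) ∷ (17 , 18) ∷ []) ∷
    ((0 , 0) ∷ (1 , 4) ∷ (2 , 2) ∷ (13 , 8) ∷ []) ∷
    ((0 , 0) ∷ (9 , 4) ∷ (18 , 2) ∷ (17 , 8) ∷ []) ∷
    ((0 , 0) ∷ (6 , 22) ∷ (12 , 10) ∷ (18 , 12) ∷ []) ∷
    ((0 , 0) ∷ (16 , 22) ∷ (12 , 22) ∷ (8 , 0) ∷ []) ∷
    ((0 , 0) ∷ (6 , 23) ∷ (12 , 23) ∷ (18 , 0) ∷ []) ∷
    ((0 , 0) ∷ (6 , 7) ∷ (2 , 19) ∷ (8 , 12) ∷ []) ∷ [])

packing-100×24 : Packing 100 24 1 0
packing-100×24 = liftPacking refl (divides 4 refl) base-20×24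

packing-20×120 : Packing 20 120 0 1
packing-20×120 = liftPacking refl (1∣ 4) base-4×120

packing-4×600 : Packing 4 600 0 1
packing-4×600 = swapPacking (liftPacking refl (divides 24 refl) (swapPacking base-4×120))

leaveExp₁ : ℕ → ℕ → ℕ
leaveExp₁ zero    _ = 0
leaveExp₁ (suc a) _ = a

leaveExp₂ : ℕ → ℕ → ℕ
leaveExp₂ zero    zero    = 0
leaveExp₂ zero    (suc b) = b
leaveExp₂ (suc _) b       = b

packing : ∀ a b → Packing (4 * 5 ^ a) (24 * 5 ^ b) (leaveExp₁ a b) (leaveExp₂ a b)
packing zero          zero          = trivialPacking
packing zero          (suc zero)    = trivialPacking
packing (suc zero)    zero          = trivialPacking
packing (suc (suc a)) b             = resize (*-assoc 4 5 (5 ^ suc a)) refl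
  (extend₁ {20} {24} {a} {b} (resize (sym (*-assoc 4 5 (5 ^ a))) refl (packing (suc a) b)) packing-100×24)
packing (suc zero)    (suc b)       = extend₂ {24} {20} {b} {0} (packing 1 b) packing-20×120
packing zero          (suc (suc b)) = resize refl (*-assoc 24 5 (5 ^ suc b))
  (extend₂ {120} {4} {b} {0} (resize refl (sym (*-assoc 24 5 (5 ^ b))) (packing 0 (suc b))) packing-4×600)

c*x/c≡x : ∀ c .{{_ : NonZero c}} x → c * x / c ≡ x
c*x/c≡x c x = trans (cong (_/ c) (*-comm c x)) (m*n/n≡m x c)

quotient₁ : ∀ a b → _/_ (4 * 5 ^ a) (gpar a b) {{gpar-nz a b}} ≡ 5 ^ leaveExp₁ a b
quotient₁ zero    b = refl
quotient₁ (suc a) b = trans (cong (_/ 20) (sym (*-assoc 4 5 (5 ^ a)))) (c*x/c≡x 20 (5 ^ a))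

quotient₂ : ∀ a b → _/_ (24 * 5 ^ b) (hpar a b) {{hpar-nz a b}} ≡ 5 ^ leaveExp₂ a b
quotient₂ zero    zero    = refl
quotient₂ zero    (suc b) = trans (cong (_/ 120) (sym (*-assoc 24 5 (5 ^ b)))) (c*x/c≡x 120 (5 ^ b))
quotient₂ (suc a) b       = c*x/c≡x 24 (5 ^ b)

lemma4p6 : (a b : ℕ) → BDP45 (4 * 5 ^ a) (24 * 5 ^ b) (gpar a b) (hpar a b) {{gpar-nz a b}} {{hpar-nz a b}}
lemma4p6 a b = packing⇒BDP45 {{gpar-nz a b}} {{hpar-nz a b}} (packing a b) (quotient₁ a b) (quotient₂ a b)
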